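{- Let $d$ be either $0$ or a positive square-free integer, $K=\mathbb{Q}(\sqrt{ -d})$, $R$ the ring of integers of $K$. (a) $\chi(\Gamma_{1,n})=2$ for all $n\geq1$. (b) $\chi(\Gamma^{un}_{2,n})=2n+1$ for all $n\geq1$.
   Context: $\chi$ denotes the chromatic number. The zero-divisor graph $\Gamma(M_2(R))$ is the directed graph whose vertices are the nonzero (left or right) zero-divisors of $M_2(R)$, with an edge $v_1\to v_2$ between distinct vertices iff $v_1v_2=0$. For an integer $N\geq1$ and $t\in R$, let $S_{tc,1,t,N}=\{\lambda\begin{bmatrix}1&t\\t^2&t^3\end{bmatrix}:\lambda\in\mathbb{Z},\,1\leq|\lambda|\leq N\}$ and $S_{tc,2,N}=\{\begin{bmatrix}0&0\\0&\lambda\end{bmatrix}:\lambda\in\mathbb{Z},\,1\leq|\lambda|\leq N\}$. Let $\Gamma_{1,N}$ be the induced subgraph of $\Gamma(M_2(R))$ on $S_{tc,1,0,N}\cup S_{tc,2,N}$, regarded as an undirected graph. Let $U=\{\pm1\}$ if $d\neq1,3$, $U=\{\pm1,\pm i\}$ if $d=1$ ($i=\sqrt{ -1}$), $U=\{\pm1,\pm\omega,\pm\omega^2\}$ if $d=3$ ($\omega$ a primitive third root of unity); let $\Gamma_{2,N}$ be the induced subgraph of $\Gamma(M_2(R))$ on $\bigcup_{j\in U}S_{tc,1,j,N}$, and $\Gamma^{un}_{2,N}$ its underlying undirected graph (distinct $v_1,v_2$ adjacent iff $v_1v_2=0$ or $v_2v_1=0$). -}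

module Defs where

open import Data.Nat as ℕ using (ℕ; zero; suc; _%_; _/_; _≡ᵇ_)
open import Data.Nat.Divisibility using (_∣_)
open import Data.Integer as ℤ using (ℤ; +_; ∣_∣)
open import Data.Bool using (if_then_else_)
open import Data.Fin using (Fin)
open import Data.Product using (Σ; _×_; _,_; proj₁)
open import Data.Sum using (_⊎_)
open import Data.Empty using (⊥)
open import Relation.Binary.PropositionalEquality using (_≡_; _≢_)

SquareFree : ℕ → Set
SquareFree d = ∀ p → p ℕ.* p ∣ d → p ≡ 1

-- The ring of integers R of K = Q(√-d).
--  * d = 0 : K = Q, R = ℤ.
--  * d > 0 square-free : R = ℤ[θ] = {a + bθ}, represented by pairs (a , b),
--    where θ = √-d (θ² = -d) if d ≢ 3 (mod 4), and
--    θ = (1 + √-d)/2 (θ² = θ - (d+1)/4) if d ≡ 3 (mod 4).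
--  In both cases θ² = p d · θ + q d.

R : ℕ → Set
R zero    = ℤ
R (suc _) = ℤ × ℤ

pθ : ℕ → ℤ
pθ d = if (d % 4) ≡ᵇ 3 then + 1 else + 0

qθ : ℕ → ℤ
qθ d = if (d % 4) ≡ᵇ 3 then ℤ.- (+ ((d ℕ.+ 1) / 4)) else ℤ.- (+ d)

ι : (d : ℕ) → ℤ → R d
ι zero    n = n
ι (suc _) n = n , + 0

0R 1R : (d : ℕ) → R d
0R d = ι d (+ 0)
1R d = ι d (+ 1)

addR : (d : ℕ) → R d → R d → R d
addR zero    x y = x ℤ.+ y
addR (suc _) (a , b) (c , e) = a ℤ.+ c , b ℤ.+ e

negR : (d : ℕ) → R d → R d
negR zero    x = ℤ.- x
negR (suc _) (a , b) = ℤ.- a , ℤ.- b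

mulR : (d : ℕ) → R d → R d → R d
mulR zero    x y = x ℤ.* y
mulR (suc k) (a , b) (c , e) =
  a ℤ.* c ℤ.+ b ℤ.* e ℤ.* qθ (suc k) ,
  a ℤ.* e ℤ.+ b ℤ.* c ℤ.+ b ℤ.* e ℤ.* pθ (suc k)

-- i = √-1 ∈ ℤ[i] (d = 1) and ω = θ - 1 = (-1 + √-3)/2 ∈ ℤ[θ] (d = 3),
-- a primitive third root of unity.
iR : R 1
iR = + 0 , + 1

ωR : R 3
ωR = ℤ.- (+ 1) , + 1

U : (d : ℕ) → R d → Set
U d x = (x ≡ 1R d ⊎ x ≡ negR d (1R d)) ⊎ extra d x
  where
  extra : (d : ℕ) → R d → Set
  extra 1 x = x ≡ iR ⊎ x ≡ negR 1 iR
  extra 3 x = (x ≡ ωR ⊎ x ≡ negR 3 ωR) ⊎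
              (x ≡ mulR 3 ωR ωR ⊎ x ≡ negR 3 (mulR 3 ωR ωR))
  extra _ _ = ⊥

record Mat (A : Set) : Set where
  constructor mat
  field
    m11 m12 m21 m22 : A

matMul : (d : ℕ) → Mat (R d) → Mat (R d) → Mat (R d)
matMul d (mat a b c e) (mat a' b' c' e') =
  mat (addR d (mulR d a a') (mulR d b c')) (addR d (mulR d a b') (mulR d b e'))
      (addR d (mulR d c a') (mulR d e c')) (addR d (mulR d c b') (mulR d e e'))

zeroMat : (d : ℕ) → Mat (R d)
zeroMat d = mat (0R d) (0R d) (0R d) (0R d)

scal : (d : ℕ) → ℤ → Mat (R d) → Mat (R d)
scal d λ' (mat a b c e) =
  mat (mulR d (ι d λ') a) (mulR d (ι d λ') b) (mulR d (ι d λ') c) (mulR d (ι d λ') e)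

Tmat : (d : ℕ) → R d → Mat (R d)
Tmat d t = mat (1R d) t (mulR d t t) (mulR d (mulR d t t) t)

S1 : (d : ℕ) → R d → ℕ → Mat (R d) → Set
S1 d t N M = Σ ℤ λ λ' → (1 ℕ.≤ ∣ λ' ∣ × ∣ λ' ∣ ℕ.≤ N) × M ≡ scal d λ' (Tmat d t)

S2 : (d : ℕ) → ℕ → Mat (R d) → Set
S2 d N M = Σ ℤ λ λ' → (1 ℕ.≤ ∣ λ' ∣ × ∣ λ' ∣ ℕ.≤ N) × M ≡ mat (0R d) (0R d) (0R d) (ι d λ')

Vert : (d : ℕ) → (Mat (R d) → Set) → Set
Vert d P = Σ (Mat (R d)) P

Adj : (d : ℕ) (P : Mat (R d) → Set) → Vert d P → Vert d P → Set
Adj d P u v = proj₁ u ≢ proj₁ v ×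
  (matMul d (proj₁ u) (proj₁ v) ≡ zeroMat d ⊎ matMul d (proj₁ v) (proj₁ u) ≡ zeroMat d)

Colorable : (V : Set) → (V → V → Set) → ℕ → Set
Colorable V E k = Σ (V → Fin k) λ c → ∀ u v → E u v → c u ≢ c v

ChromaticNumber : (V : Set) → (V → V → Set) → ℕ → Set
ChromaticNumber V E k = Colorable V E k × (∀ m → Colorable V E m → k ℕ.≤ m)

Γ1P : (d : ℕ) → ℕ → Mat (R d) → Set
Γ1P d N M = S1 d (0R d) N M ⊎ S2 d N M

Γ2P : (d : ℕ) → ℕ → Mat (R d) → Set
Γ2P d N M = Σ (R d) λ j → U d j × S1 d j N M

χ≡ : (d : ℕ) → (Mat (R d) → Set) → ℕ → Set
χ≡ d P k = ChromaticNumber (Vert d P) (Adj d P) k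

-- Write T(t) = [[1, t], [t², t³]]. Then T(j) T(k) = (1 + j k²) [[1, k], [j², j² k]], and since the
-- entries of R d are ℤ-torsion free, for nonzero integers λ, μ the product (λ T(j)) (μ T(k)) vanishes
-- iff T(j) T(k) does, i.e. iff j k² = -1.
--
-- (a) Γ₁ is bipartite with parts S_{tc,1,0} and S_{tc,2}: T(0)² and E₂₂² are nonzero, while
-- T(0) E₂₂ = 0 provides an edge.
--
-- (b) Split U into P = {1, ω, ω²} and N = -P (for d = 1, P = {1} and N = {-1, i, -i}). The equation
-- j k² = -1 has no solution with j, k ∈ P and only diagonal solutions j = k with j, k ∈ N. Hence
-- colouring λ T(j) by λ when j ∈ N (2n colours) and with one extra colour when j ∈ P is proper.
-- Conversely T(-1) T(±1) = 0, so the 2n multiples of T(-1) together with T(1) form a clique.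
module Submission where

open import Defs
open import Data.Nat using (ℕ; _≤_; _<_; _+_; _*_)
open import Data.Product using (_×_; _,_)
open import Data.Sum using (_⊎_)
open import Relation.Binary.PropositionalEquality using (_≡_)

open import Data.Nat using (zero; suc; s≤s; z≤n)
import Data.Nat.Properties as ℕP
open import Data.Integer as ℤ using (ℤ; +_; -[1+_]; ∣_∣)
import Data.Integer.Properties as ℤP
open import Data.Integer.Tactic.RingSolver using (solve-∀)
open import Data.Fin using (Fin; zero; suc; toℕ; fromℕ<; splitAt; join)
import Data.Fin.Properties as FinP
open import Data.Product using (proj₁; proj₂)
open import Data.Sum using (inj₁; inj₂; [_,_]′)
open import Data.Empty using (⊥-elim)
open import Function using (_∘_)
open import Relation.Nullary.Decidable using (decidable-stable)
open import Relation.Binary.PropositionalEquality using (_≢_; refl; sym; trans; cong; cong₂; subst; subst₂)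
open import Relation.Binary.PropositionalEquality using (module ≡-Reasoning)

clique-size≤colours : {V : Set} {E : V → V → Set} {k m : ℕ} (f : Fin k → V) →
  (∀ {i j} → i ≢ j → E (f i) (f j)) → Colorable V E m → k ≤ m
clique-size≤colours f adjacent (c , proper) = FinP.injective⇒≤ c∘f-injective
  where
  c∘f-injective : ∀ {i j} → c (f i) ≡ c (f j) → i ≡ j
  c∘f-injective {i} {j} same =
    decidable-stable (i FinP.≟ j) (λ i≢j → proper (f i) (f j) (adjacent i≢j) same)

Adj-sym : ∀ d {P} {u v : Vert d P} → Adj d P u v → Adj d P v u
Adj-sym d (u≢v , inj₁ uv≡0) = u≢v ∘ sym , inj₂ uv≡0
Adj-sym d (u≢v , inj₂ vu≡0) = u≢v ∘ sym , inj₁ vu≡0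

≥1⇒≢0 : ∀ {l} → 1 ≤ ∣ l ∣ → l ≢ + 0
≥1⇒≢0 () refl

*-≢0 : ∀ {l m} → l ≢ + 0 → m ≢ + 0 → l ℤ.* m ≢ + 0
*-≢0 {l} l≢0 m≢0 lm≡0 = [ l≢0 , m≢0 ]′ (ℤP.i*j≡0⇒i≡0∨j≡0 l lm≡0)

smul : (d : ℕ) → ℤ → R d → R d
smul zero    c x       = c ℤ.* x
smul (suc _) c (a , b) = c ℤ.* a , c ℤ.* b

mulR-ι : ∀ d c x → mulR d (ι d c) x ≡ smul d c x
mulR-ι zero    c x       = refl
mulR-ι (suc k) c (a , b) = cong₂ _,_ (constant-part c a b (qθ (suc k))) (θ-part c a b (pθ (suc k)))
  where
  constant-part : ∀ c a b q → c ℤ.* a ℤ.+ + 0 ℤ.* b ℤ.* q ≡ c ℤ.* a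
  constant-part = solve-∀
  θ-part : ∀ c a b p → c ℤ.* b ℤ.+ + 0 ℤ.* a ℤ.+ + 0 ℤ.* b ℤ.* p ≡ c ℤ.* b
  θ-part = solve-∀

smul-mulR : ∀ d c e x y → mulR d (smul d c x) (smul d e y) ≡ smul d (c ℤ.* e) (mulR d x y)
smul-mulR zero    c e x y = rearrange c e x y
  where
  rearrange : ∀ c e x y → c ℤ.* x ℤ.* (e ℤ.* y) ≡ c ℤ.* e ℤ.* (x ℤ.* y)
  rearrange = solve-∀
smul-mulR (suc k) c e (a , b) (a′ , b′) =
  cong₂ _,_ (constant-part c e a b a′ b′ (qθ (suc k))) (θ-part c e a b a′ b′ (pθ (suc k)))
  where
  constant-part : ∀ c e a b a′ b′ q →
    c ℤ.* a ℤ.* (e ℤ.* a′) ℤ.+ c ℤ.* b ℤ.* (e ℤ.* b′) ℤ.* q ≡ c ℤ.* e ℤ.* (a ℤ.* a′ ℤ.+ b ℤ.* b′ ℤ.* q)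
  constant-part = solve-∀
  θ-part : ∀ c e a b a′ b′ p →
    c ℤ.* a ℤ.* (e ℤ.* b′) ℤ.+ c ℤ.* b ℤ.* (e ℤ.* a′) ℤ.+ c ℤ.* b ℤ.* (e ℤ.* b′) ℤ.* p ≡
    c ℤ.* e ℤ.* (a ℤ.* b′ ℤ.+ b ℤ.* a′ ℤ.+ b ℤ.* b′ ℤ.* p)
  θ-part = solve-∀

smul-addR : ∀ d c x y → addR d (smul d c x) (smul d c y) ≡ smul d c (addR d x y)
smul-addR zero    c x       y         = sym (ℤP.*-distribˡ-+ c x y)
smul-addR (suc _) c (a , b) (a′ , b′) = sym (cong₂ _,_ (ℤP.*-distribˡ-+ c a a′) (ℤP.*-distribˡ-+ c b b′))

smul-0R : ∀ d c → smul d c (0R d) ≡ 0R d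
smul-0R zero    c = ℤP.*-zeroʳ c
smul-0R (suc _) c = cong₂ _,_ (ℤP.*-zeroʳ c) (ℤP.*-zeroʳ c)

smul-1R : ∀ d c → smul d c (1R d) ≡ ι d c
smul-1R zero    c = ℤP.*-identityʳ c
smul-1R (suc _) c = cong₂ _,_ (ℤP.*-identityʳ c) (ℤP.*-zeroʳ c)

smul-injective : ∀ d {c x y} → c ≢ + 0 → smul d c x ≡ smul d c y → x ≡ y
smul-injective zero    {c} {x} {y} c≢0 eq = ℤP.*-cancelˡ-≡ c x y {{ℤ.≢-nonZero c≢0}} eq
smul-injective (suc _) {c} {a , b} {a′ , b′} c≢0 eq =
  cong₂ _,_ (ℤP.*-cancelˡ-≡ c a a′ {{ℤ.≢-nonZero c≢0}} (cong proj₁ eq))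
            (ℤP.*-cancelˡ-≡ c b b′ {{ℤ.≢-nonZero c≢0}} (cong proj₂ eq))

ι-injective : ∀ d {a b} → ι d a ≡ ι d b → a ≡ b
ι-injective zero    eq = eq
ι-injective (suc _) eq = cong proj₁ eq

mat-cong : ∀ {A : Set} {a b c e a′ b′ c′ e′ : A} →
  a ≡ a′ → b ≡ b′ → c ≡ c′ → e ≡ e′ → mat a b c e ≡ mat a′ b′ c′ e′
mat-cong refl refl refl refl = refl

smulM : (d : ℕ) → ℤ → Mat (R d) → Mat (R d)
smulM d c (mat a b x e) = mat (smul d c a) (smul d c b) (smul d c x) (smul d c e)

scal≡smulM : ∀ d l A → scal d l A ≡ smulM d l A
scal≡smulM d l (mat a b x e) = mat-cong (mulR-ι d l a) (mulR-ι d l b) (mulR-ι d l x) (mulR-ι d l e)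

matMul-smulM : ∀ d l m A B → matMul d (smulM d l A) (smulM d m B) ≡ smulM d (l ℤ.* m) (matMul d A B)
matMul-smulM d l m (mat a b c e) (mat a′ b′ c′ e′) =
  mat-cong (entry a a′ b c′) (entry a b′ b e′) (entry c a′ e c′) (entry c b′ e e′)
  where
  entry : ∀ x y z w → addR d (mulR d (smul d l x) (smul d m y)) (mulR d (smul d l z) (smul d m w))
                    ≡ smul d (l ℤ.* m) (addR d (mulR d x y) (mulR d z w))
  entry x y z w rewrite smul-mulR d l m x y | smul-mulR d l m z w = smul-addR d (l ℤ.* m) _ _

smulM-zeroMat : ∀ d c → smulM d c (zeroMat d) ≡ zeroMat d
smulM-zeroMat d c = mat-cong (smul-0R d c) (smul-0R d c) (smul-0R d c) (smul-0R d c)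

smulM-≡zeroMat : ∀ d {c} X → c ≢ + 0 → smulM d c X ≡ zeroMat d → X ≡ zeroMat d
smulM-≡zeroMat d {c} (mat a b x e) c≢0 eq =
  mat-cong (entry (cong Mat.m11 eq)) (entry (cong Mat.m12 eq))
           (entry (cong Mat.m21 eq)) (entry (cong Mat.m22 eq))
  where
  entry : ∀ {y} → smul d c y ≡ 0R d → y ≡ 0R d
  entry cy≡0 = smul-injective d c≢0 (trans cy≡0 (sym (smul-0R d c)))

matMul-scal : ∀ d l m A B → matMul d (scal d l A) (scal d m B) ≡ smulM d (l ℤ.* m) (matMul d A B)
matMul-scal d l m A B =
  trans (cong₂ (matMul d) (scal≡smulM d l A) (scal≡smulM d m B)) (matMul-smulM d l m A B)

matMul-scal-≡0⇒ : ∀ d {l m A B} → l ≢ + 0 → m ≢ + 0 →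
  matMul d (scal d l A) (scal d m B) ≡ zeroMat d → matMul d A B ≡ zeroMat d
matMul-scal-≡0⇒ d {l} {m} {A} {B} l≢0 m≢0 eq =
  smulM-≡zeroMat d (matMul d A B) (*-≢0 l≢0 m≢0) (trans (sym (matMul-scal d l m A B)) eq)

matMul-scal-≡0⇐ : ∀ d {l m A B} →
  matMul d A B ≡ zeroMat d → matMul d (scal d l A) (scal d m B) ≡ zeroMat d
matMul-scal-≡0⇐ d {l} {m} {A} {B} eq = begin
  matMul d (scal d l A) (scal d m B)  ≡⟨ matMul-scal d l m A B ⟩
  smulM d (l ℤ.* m) (matMul d A B)    ≡⟨ cong (smulM d (l ℤ.* m)) eq ⟩
  smulM d (l ℤ.* m) (zeroMat d)       ≡⟨ smulM-zeroMat d (l ℤ.* m) ⟩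
  zeroMat d                           ∎
  where open ≡-Reasoning

scal-Tmat-injective : ∀ d {l m j k} → l ≢ + 0 →
  scal d l (Tmat d j) ≡ scal d m (Tmat d k) → l ≡ m × j ≡ k
scal-Tmat-injective d {l} {m} {j} {k} l≢0 eq = l≡m , smul-injective d l≢0 lj≡lk
  where
  open ≡-Reasoning
  l≡m : l ≡ m
  l≡m = ι-injective d (begin
    ι d l                    ≡⟨ sym (smul-1R d l) ⟩
    smul d l (1R d)          ≡⟨ sym (mulR-ι d l (1R d)) ⟩
    mulR d (ι d l) (1R d)    ≡⟨ cong Mat.m11 eq ⟩
    mulR d (ι d m) (1R d)    ≡⟨ mulR-ι d m (1R d) ⟩
    smul d m (1R d)          ≡⟨ smul-1R d m ⟩
    ι d m                    ∎)
  lj≡lk : smul d l j ≡ smul d l k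
  lj≡lk = begin
    smul d l j               ≡⟨ sym (mulR-ι d l j) ⟩
    mulR d (ι d l) j         ≡⟨ cong Mat.m12 eq ⟩
    mulR d (ι d m) k         ≡⟨ cong (λ c → mulR d (ι d c) k) (sym l≡m) ⟩
    mulR d (ι d l) k         ≡⟨ mulR-ι d l k ⟩
    smul d l k               ∎

E₂₂ T₀ : (d : ℕ) → Mat (R d)
E₂₂ d = mat (0R d) (0R d) (0R d) (1R d)
T₀ d  = Tmat d (0R d)

diag≡scal-E₂₂ : ∀ d l → mat (0R d) (0R d) (0R d) (ι d l) ≡ scal d l (E₂₂ d)
diag≡scal-E₂₂ d l = sym (trans (scal≡smulM d l (E₂₂ d))
  (mat-cong (smul-0R d l) (smul-0R d l) (smul-0R d l) (smul-1R d l)))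

T₀·T₀≢0 : ∀ d → matMul d (T₀ d) (T₀ d) ≢ zeroMat d
T₀·T₀≢0 zero    ()
T₀·T₀≢0 (suc _) ()

E₂₂·E₂₂≢0 : ∀ d → matMul d (E₂₂ d) (E₂₂ d) ≢ zeroMat d
E₂₂·E₂₂≢0 zero    ()
E₂₂·E₂₂≢0 (suc _) ()

T₀·E₂₂≡0 : ∀ d → matMul d (T₀ d) (E₂₂ d) ≡ zeroMat d
T₀·E₂₂≡0 zero    = refl
T₀·E₂₂≡0 (suc _) = refl

T₀≢E₂₂ : ∀ d → scal d (+ 1) (T₀ d) ≢ mat (0R d) (0R d) (0R d) (ι d (+ 1))
T₀≢E₂₂ zero    ()
T₀≢E₂₂ (suc _) ()

S1-annihilation-free : ∀ d {n A B} → S1 d (0R d) n A → S1 d (0R d) n B → matMul d A B ≢ zeroMat d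
S1-annihilation-free d (l , (l≥1 , _) , refl) (m , (m≥1 , _) , refl) =
  T₀·T₀≢0 d ∘ matMul-scal-≡0⇒ d (≥1⇒≢0 l≥1) (≥1⇒≢0 m≥1)

S2-annihilation-free : ∀ d {n A B} → S2 d n A → S2 d n B → matMul d A B ≢ zeroMat d
S2-annihilation-free d (l , (l≥1 , _) , refl) (m , (m≥1 , _) , refl) =
  E₂₂·E₂₂≢0 d ∘ matMul-scal-≡0⇒ d (≥1⇒≢0 l≥1) (≥1⇒≢0 m≥1)
    ∘ subst₂ (λ X Y → matMul d X Y ≡ zeroMat d) (diag≡scal-E₂₂ d l) (diag≡scal-E₂₂ d m)

Γ1-colour : ∀ d n → Vert d (Γ1P d n) → Fin 2
Γ1-colour d n (_ , inj₁ _) = zero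
Γ1-colour d n (_ , inj₂ _) = suc zero

Γ1-colour-proper : ∀ d n u v → Adj d (Γ1P d n) u v → Γ1-colour d n u ≢ Γ1-colour d n v
Γ1-colour-proper d n (_ , inj₁ a) (_ , inj₁ b) (_ , ab⊎ba) _ =
  [ S1-annihilation-free d a b , S1-annihilation-free d b a ]′ ab⊎ba
Γ1-colour-proper d n (_ , inj₂ a) (_ , inj₂ b) (_ , ab⊎ba) _ =
  [ S2-annihilation-free d a b , S2-annihilation-free d b a ]′ ab⊎ba
Γ1-colour-proper d n (_ , inj₁ _) (_ , inj₂ _) _ ()
Γ1-colour-proper d n (_ , inj₂ _) (_ , inj₁ _) _ ()

Γ1-edge : ∀ d n → 1 ≤ n → Fin 2 → Vert d (Γ1P d n)
Γ1-edge d n n≥1 zero    = _ , inj₁ (+ 1 , (s≤s z≤n , n≥1) , refl)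
Γ1-edge d n n≥1 (suc _) = _ , inj₂ (+ 1 , (s≤s z≤n , n≥1) , refl)

T₀-E₂₂-adjacent : ∀ d n (n≥1 : 1 ≤ n) →
  Adj d (Γ1P d n) (Γ1-edge d n n≥1 zero) (Γ1-edge d n n≥1 (suc zero))
T₀-E₂₂-adjacent d n n≥1 = T₀≢E₂₂ d , inj₁ (subst (λ Y → matMul d (scal d (+ 1) (T₀ d)) Y ≡ zeroMat d)
  (sym (diag≡scal-E₂₂ d (+ 1))) (matMul-scal-≡0⇐ d (T₀·E₂₂≡0 d)))

Γ1-edge-adjacent : ∀ d n (n≥1 : 1 ≤ n) {i j} → i ≢ j →
  Adj d (Γ1P d n) (Γ1-edge d n n≥1 i) (Γ1-edge d n n≥1 j)
Γ1-edge-adjacent d n n≥1 {zero}     {zero}     i≢j = ⊥-elim (i≢j refl)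
Γ1-edge-adjacent d n n≥1 {zero}     {suc zero} _   = T₀-E₂₂-adjacent d n n≥1
Γ1-edge-adjacent d n n≥1 {suc zero} {zero}     _   =
  Adj-sym d {Γ1P d n} {Γ1-edge d n n≥1 zero} {Γ1-edge d n n≥1 (suc zero)} (T₀-E₂₂-adjacent d n n≥1)
Γ1-edge-adjacent d n n≥1 {suc zero} {suc zero} i≢j = ⊥-elim (i≢j refl)

χ-Γ1 : ∀ d n → 1 ≤ n → χ≡ d (Γ1P d n) 2
χ-Γ1 d n n≥1 = (Γ1-colour d n , Γ1-colour-proper d n) ,
  λ m → clique-size≤colours (Γ1-edge d n n≥1) (Γ1-edge-adjacent d n n≥1)

data PosUnit : (d : ℕ) → R d → Set where
  one : ∀ {d} → PosUnit d (1R d)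
  ω   : PosUnit 3 ωR
  ω²  : PosUnit 3 (mulR 3 ωR ωR)

data NegUnit : (d : ℕ) → R d → Set where
  -one : ∀ {d} → NegUnit d (negR d (1R d))
  +i   : NegUnit 1 iR
  -i   : NegUnit 1 (negR 1 iR)
  -ω   : NegUnit 3 (negR 3 ωR)
  -ω²  : NegUnit 3 (negR 3 (mulR 3 ωR ωR))

U⇒PosUnit⊎NegUnit : ∀ d {j} → U d j → PosUnit d j ⊎ NegUnit d j
U⇒PosUnit⊎NegUnit d (inj₁ (inj₁ refl))           = inj₁ one
U⇒PosUnit⊎NegUnit d (inj₁ (inj₂ refl))           = inj₂ -one
U⇒PosUnit⊎NegUnit 0 (inj₂ ())
U⇒PosUnit⊎NegUnit 1 (inj₂ (inj₁ refl))           = inj₂ +i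
U⇒PosUnit⊎NegUnit 1 (inj₂ (inj₂ refl))           = inj₂ -i
U⇒PosUnit⊎NegUnit 2 (inj₂ ())
U⇒PosUnit⊎NegUnit 3 (inj₂ (inj₁ (inj₁ refl)))    = inj₁ ω
U⇒PosUnit⊎NegUnit 3 (inj₂ (inj₁ (inj₂ refl)))    = inj₂ -ω
U⇒PosUnit⊎NegUnit 3 (inj₂ (inj₂ (inj₁ refl)))    = inj₁ ω²
U⇒PosUnit⊎NegUnit 3 (inj₂ (inj₂ (inj₂ refl)))    = inj₂ -ω²
U⇒PosUnit⊎NegUnit (suc (suc (suc (suc _)))) (inj₂ ())

PosUnit-Tmat-mul≢0 : ∀ {d j k} → PosUnit d j → PosUnit d k →
  matMul d (Tmat d j) (Tmat d k) ≢ zeroMat d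
PosUnit-Tmat-mul≢0 {zero}  one one ()
PosUnit-Tmat-mul≢0 {suc _} one one ()
PosUnit-Tmat-mul≢0 one ω  ()
PosUnit-Tmat-mul≢0 one ω² ()
PosUnit-Tmat-mul≢0 ω  one ()
PosUnit-Tmat-mul≢0 ω  ω   ()
PosUnit-Tmat-mul≢0 ω  ω²  ()
PosUnit-Tmat-mul≢0 ω² one ()
PosUnit-Tmat-mul≢0 ω² ω   ()
PosUnit-Tmat-mul≢0 ω² ω²  ()

NegUnit-Tmat-mul≡0⇒≡ : ∀ {d j k} → NegUnit d j → NegUnit d k →
  matMul d (Tmat d j) (Tmat d k) ≡ zeroMat d → j ≡ k
NegUnit-Tmat-mul≡0⇒≡ -one -one _  = refl
NegUnit-Tmat-mul≡0⇒≡ -one +i   ()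
NegUnit-Tmat-mul≡0⇒≡ -one -i   ()
NegUnit-Tmat-mul≡0⇒≡ -one -ω   ()
NegUnit-Tmat-mul≡0⇒≡ -one -ω²  ()
NegUnit-Tmat-mul≡0⇒≡ +i   -one ()
NegUnit-Tmat-mul≡0⇒≡ +i   +i   _ = refl
NegUnit-Tmat-mul≡0⇒≡ +i   -i   ()
NegUnit-Tmat-mul≡0⇒≡ -i   -one ()
NegUnit-Tmat-mul≡0⇒≡ -i   +i   ()
NegUnit-Tmat-mul≡0⇒≡ -i   -i   _ = refl
NegUnit-Tmat-mul≡0⇒≡ -ω   -one ()
NegUnit-Tmat-mul≡0⇒≡ -ω   -ω   _ = refl
NegUnit-Tmat-mul≡0⇒≡ -ω   -ω²  ()
NegUnit-Tmat-mul≡0⇒≡ -ω²  -one ()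
NegUnit-Tmat-mul≡0⇒≡ -ω²  -ω   ()
NegUnit-Tmat-mul≡0⇒≡ -ω²  -ω²  _ = refl

T₋₁ T₁ : (d : ℕ) → Mat (R d)
T₋₁ d = Tmat d (negR d (1R d))
T₁  d = Tmat d (1R d)

T₋₁·T₋₁≡0 : ∀ d → matMul d (T₋₁ d) (T₋₁ d) ≡ zeroMat d
T₋₁·T₋₁≡0 zero    = refl
T₋₁·T₋₁≡0 (suc _) = refl

T₋₁·T₁≡0 : ∀ d → matMul d (T₋₁ d) (T₁ d) ≡ zeroMat d
T₋₁·T₁≡0 zero    = refl
T₋₁·T₁≡0 (suc _) = refl

-1R≢1R : ∀ d → negR d (1R d) ≢ 1R d
-1R≢1R zero    ()
-1R≢1R (suc _) ()

Bounded : ℕ → ℤ → Set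
Bounded n l = 1 ≤ ∣ l ∣ × ∣ l ∣ ≤ n

-- The value at 0 is junk: 0 is not a scalar of any vertex.
signedIndex : ℕ → ℤ → ℕ
signedIndex n (+ zero)  = 0
signedIndex n (+ suc m) = m
signedIndex n -[1+ m ]  = n + m

signedIndex< : ∀ n l → Bounded n l → signedIndex n l < 2 * n
signedIndex< n (+ suc _) (_ , l≤n) = ℕP.<-≤-trans l≤n (ℕP.m≤m+n n (n + 0))
signedIndex< n -[1+ _ ] (_ , l≤n) rewrite ℕP.+-identityʳ n = ℕP.+-monoʳ-< n l≤n

signedIndex-injective : ∀ n {l l′} → Bounded n l → Bounded n l′ →
  signedIndex n l ≡ signedIndex n l′ → l ≡ l′
signedIndex-injective n {+ suc _}   {+ suc _}    _         _         refl = refl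
signedIndex-injective n {+ suc _}   { -[1+ m′ ]} (_ , l≤n) _         refl =
  ⊥-elim (ℕP.<-irrefl refl (ℕP.<-≤-trans l≤n (ℕP.m≤m+n n m′)))
signedIndex-injective n { -[1+ m ]} {+ suc _}    _         (_ , l≤n) refl =
  ⊥-elim (ℕP.<-irrefl refl (ℕP.<-≤-trans l≤n (ℕP.m≤m+n n m)))
signedIndex-injective n { -[1+ m ]} { -[1+ m′ ]} _         _         eq   =
  cong -[1+_] (ℕP.+-cancelˡ-≡ n m m′ eq)

signedScalar : ∀ n → Fin (2 * n) → ℤ
signedScalar n x = [ (λ y → + suc (toℕ y)) , (λ y → -[1+ toℕ y ]) ]′ (splitAt n x)

signedScalar-bounded : ∀ n x → Bounded n (signedScalar n x)
signedScalar-bounded n x with splitAt n x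
... | inj₁ y = s≤s z≤n , FinP.toℕ<n y
... | inj₂ y = s≤s z≤n , subst (toℕ y <_) (ℕP.+-identityʳ n) (FinP.toℕ<n y)

signedScalar≢0 : ∀ n x → signedScalar n x ≢ + 0
signedScalar≢0 n x = ≥1⇒≢0 (proj₁ (signedScalar-bounded n x))

signedIndex-signedScalar : ∀ n x → signedIndex n (signedScalar n x) ≡ toℕ x
signedIndex-signedScalar n x =
  trans (onSum (splitAt n x)) (cong toℕ (FinP.join-splitAt n (n + 0) x))
  where
  onSum : ∀ s → signedIndex n ([ (λ y → + suc (toℕ y)) , (λ y → -[1+ toℕ y ]) ]′ s)
                ≡ toℕ (join n (n + 0) s)
  onSum (inj₁ y) = sym (FinP.toℕ-↑ˡ y (n + 0))
  onSum (inj₂ y) = sym (FinP.toℕ-↑ʳ n y)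

signedScalar-injective : ∀ n {x y} → signedScalar n x ≡ signedScalar n y → x ≡ y
signedScalar-injective n {x} {y} eq = FinP.toℕ-injective (begin
  toℕ x                           ≡⟨ sym (signedIndex-signedScalar n x) ⟩
  signedIndex n (signedScalar n x) ≡⟨ cong (signedIndex n) eq ⟩
  signedIndex n (signedScalar n y) ≡⟨ signedIndex-signedScalar n y ⟩
  toℕ y                           ∎)
  where open ≡-Reasoning

2n<2n+1 : ∀ n → 2 * n < 2 * n + 1
2n<2n+1 n = ℕP.m<m+n (2 * n) (s≤s z≤n)

classColour : ∀ {d j} n l → PosUnit d j ⊎ NegUnit d j → Bounded n l → Fin (2 * n + 1)
classColour n l (inj₁ _) _ = fromℕ< (2n<2n+1 n)
classColour n l (inj₂ _) b = fromℕ< (ℕP.<-trans (signedIndex< n l b) (2n<2n+1 n))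

classColour-≡ : ∀ {d j k} n l m (cj : PosUnit d j ⊎ NegUnit d j) (ck : PosUnit d k ⊎ NegUnit d k)
  (bl : Bounded n l) (bm : Bounded n m) → classColour n l cj bl ≡ classColour n m ck bm →
  (PosUnit d j × PosUnit d k) ⊎ (NegUnit d j × NegUnit d k × l ≡ m)
classColour-≡ n l m (inj₁ pj) (inj₁ pk) _  _  _    = inj₁ (pj , pk)
classColour-≡ n l m (inj₁ _)  (inj₂ _)  _  bm same =
  ⊥-elim (ℕP.<-irrefl (sym (FinP.fromℕ<-injective _ _ _ _ same)) (signedIndex< n m bm))
classColour-≡ n l m (inj₂ _)  (inj₁ _)  bl _  same =
  ⊥-elim (ℕP.<-irrefl (FinP.fromℕ<-injective _ _ _ _ same) (signedIndex< n l bl))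
classColour-≡ n l m (inj₂ nj) (inj₂ nk) bl bm same =
  inj₂ (nj , nk , signedIndex-injective n bl bm (FinP.fromℕ<-injective _ _ _ _ same))

Γ2-colour : ∀ d n → Vert d (Γ2P d n) → Fin (2 * n + 1)
Γ2-colour d n (_ , _ , uj , l , bl , _) = classColour n l (U⇒PosUnit⊎NegUnit d uj) bl

Γ2-colour-proper : ∀ d n u v → Adj d (Γ2P d n) u v → Γ2-colour d n u ≢ Γ2-colour d n v
Γ2-colour-proper d n (_ , j , uj , l , bl , refl) (_ , k , uk , m , bm , refl) (distinct , ab⊎ba) same
  with classColour-≡ n l m (U⇒PosUnit⊎NegUnit d uj) (U⇒PosUnit⊎NegUnit d uk) bl bm same
... | inj₁ (pj , pk) =
  [ PosUnit-Tmat-mul≢0 pj pk ∘ matMul-scal-≡0⇒ d l≢0 m≢0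
  , PosUnit-Tmat-mul≢0 pk pj ∘ matMul-scal-≡0⇒ d m≢0 l≢0 ]′ ab⊎ba
  where
  l≢0 = ≥1⇒≢0 (proj₁ bl)
  m≢0 = ≥1⇒≢0 (proj₁ bm)
... | inj₂ (nj , nk , refl) =
  [ distinct ∘ cong (scal d l ∘ Tmat d) ∘ NegUnit-Tmat-mul≡0⇒≡ nj nk ∘ matMul-scal-≡0⇒ d l≢0 l≢0
  , distinct ∘ cong (scal d l ∘ Tmat d) ∘ sym ∘ NegUnit-Tmat-mul≡0⇒≡ nk nj ∘ matMul-scal-≡0⇒ d l≢0 l≢0
  ]′ ab⊎ba
  where
  l≢0 = ≥1⇒≢0 (proj₁ bl)

splitAt-injective : ∀ m {n} {i j : Fin (m + n)} → splitAt m i ≡ splitAt m j → i ≡ j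
splitAt-injective m {n} {i} {j} eq =
  trans (sym (FinP.join-splitAt m n i)) (trans (cong (join m n) eq) (FinP.join-splitAt m n j))

Γ2-clique : ∀ d n → 1 ≤ n → Fin (2 * n) ⊎ Fin 1 → Vert d (Γ2P d n)
Γ2-clique d n _   (inj₁ x) =
  _ , negR d (1R d) , inj₁ (inj₂ refl) , signedScalar n x , signedScalar-bounded n x , refl
Γ2-clique d n n≥1 (inj₂ _) = _ , 1R d , inj₁ (inj₁ refl) , + 1 , (s≤s z≤n , n≥1) , refl

Γ2-clique-injective : ∀ d n (n≥1 : 1 ≤ n) s t →
  proj₁ (Γ2-clique d n n≥1 s) ≡ proj₁ (Γ2-clique d n n≥1 t) → s ≡ t
Γ2-clique-injective d n _ (inj₁ x)    (inj₁ _)    eq =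
  cong inj₁ (signedScalar-injective n (proj₁ (scal-Tmat-injective d (signedScalar≢0 n x) eq)))
Γ2-clique-injective d n _ (inj₁ x)    (inj₂ _)    eq =
  ⊥-elim (-1R≢1R d (proj₂ (scal-Tmat-injective d (signedScalar≢0 n x) eq)))
Γ2-clique-injective d n _ (inj₂ _)    (inj₁ _)    eq =
  ⊥-elim (-1R≢1R d (sym (proj₂ (scal-Tmat-injective d (λ ()) eq))))
Γ2-clique-injective d n _ (inj₂ zero) (inj₂ zero) _  = refl

Γ2-clique-adjacent : ∀ d n (n≥1 : 1 ≤ n) {s t} → s ≢ t →
  Adj d (Γ2P d n) (Γ2-clique d n n≥1 s) (Γ2-clique d n n≥1 t)
Γ2-clique-adjacent d n n≥1 {s} {t} s≢t = s≢t ∘ Γ2-clique-injective d n n≥1 s t , annihilates s t s≢t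
  where
  annihilates : ∀ s t → s ≢ t →
    matMul d (proj₁ (Γ2-clique d n n≥1 s)) (proj₁ (Γ2-clique d n n≥1 t)) ≡ zeroMat d ⊎
    matMul d (proj₁ (Γ2-clique d n n≥1 t)) (proj₁ (Γ2-clique d n n≥1 s)) ≡ zeroMat d
  annihilates (inj₁ _)    (inj₁ _)    _   = inj₁ (matMul-scal-≡0⇐ d (T₋₁·T₋₁≡0 d))
  annihilates (inj₁ _)    (inj₂ _)    _   = inj₁ (matMul-scal-≡0⇐ d (T₋₁·T₁≡0 d))
  annihilates (inj₂ _)    (inj₁ _)    _   = inj₂ (matMul-scal-≡0⇐ d (T₋₁·T₁≡0 d))
  annihilates (inj₂ zero) (inj₂ zero) s≢t = ⊥-elim (s≢t refl)

χ-Γ2 : ∀ d n → 1 ≤ n → χ≡ d (Γ2P d n) (2 * n + 1)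
χ-Γ2 d n n≥1 = (Γ2-colour d n , Γ2-colour-proper d n) ,
  λ m → clique-size≤colours (Γ2-clique d n n≥1 ∘ splitAt (2 * n))
          (λ i≢j → Γ2-clique-adjacent d n n≥1 (i≢j ∘ splitAt-injective (2 * n)))

theorem3p18 : (d : ℕ) → (d ≡ 0 ⊎ (0 < d × SquareFree d)) →
    ((n : ℕ) → 1 ≤ n → χ≡ d (Γ1P d n) 2) ×
    ((n : ℕ) → 1 ≤ n → χ≡ d (Γ2P d n) (2 * n + 1))
theorem3p18 d _ = χ-Γ1 d , χ-Γ2 d
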